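{- Every finite graph has a subdivision that is a Diophantine graph. In particular, every finite graph is a minor of a Diophantine graph.
   Context: For a finite set $V$ of positive integers, the Diophantine graph $D(V)$ has vertex set $V$, and two distinct elements $a,b\in V$ are linked by an edge if and only if $ab+1$ is a perfect square. A finite graph is called Diophantine if it is isomorphic to $D(V)$ for some finite set $V$ of positive integers. A subdivision of a graph is obtained by replacing edges with paths whose internal vertices are new. -}

module Defs where

open import Data.Nat using (ℕ; _*_; _+_; _≥_)
open import Data.Bool using (Bool; true; false)
open import Data.Fin using (Fin; _<_)
open import Data.Maybe using (Maybe; just)
open import Data.List using (List; []; _∷_; _++_; [_])
open import Data.List.Relation.Unary.All using (All)
open import Data.List.Relation.Unary.Linked using (Linked)
open import Data.List.Relation.Unary.Unique.Propositional using (Unique)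
open import Data.List.Membership.Propositional using (_∈_; _∉_)
open import Data.Product using (Σ; ∃; ∃-syntax; _×_)
open import Data.Sum using (_⊎_)
open import Data.Empty using (⊥)
open import Relation.Nullary using (¬_)
open import Relation.Binary.PropositionalEquality using (_≡_; _≢_)
open import Function.Definitions using (Injective)
open import Function.Bundles using (_⇔_)

record Graph : Set where
  field
    n      : ℕ
    adj    : Fin n → Fin n → Bool
    sym    : ∀ x y → adj x y ≡ adj y x
    irrefl : ∀ x → adj x x ≡ false

open Graph public

Adj : (G : Graph) → Fin (n G) → Fin (n G) → Set
Adj G x y = adj G x y ≡ true

IsSquare : ℕ → Set
IsSquare m = ∃[ k ] m ≡ k * k

-- H is Diophantine: H ≅ D(V) for a finite set V of positive integers,
-- i.e. there is an injective labelling f of the vertices by positive integers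
-- (V = image of f) such that distinct x, y are adjacent iff f x * f y + 1 is a square.
IsDiophantine : Graph → Set
IsDiophantine H =
  Σ (Fin (n H) → ℕ) λ f →
    Injective _≡_ _≡_ f
    × (∀ x → f x ≥ 1)
    × (∀ x y → x ≢ y → (Adj H x y ⇔ IsSquare (f x * f y + 1)))

data Consec {A : Set} (x y : A) : List A → Set where
  here  : ∀ {zs} → Consec x y (x ∷ y ∷ zs)
  there : ∀ {z zs} → Consec x y zs → Consec x y (z ∷ zs)

-- H is a subdivision of G: every edge {u,v} (u < v) of G is replaced by the path
--   φ u , inner u v , φ v   in H
-- whose internal vertices are new (not branch vertices), pairwise distinct, and
-- disjoint from the internal vertices of the other paths; H consists exactly of
-- the branch vertices and these paths (all vertices and all edges of H are covered).
record SubdivisionOf (H G : Graph) : Set where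
  field
    φ     : Fin (n G) → Fin (n H)
    φ-inj : Injective _≡_ _≡_ φ
    inner : Fin (n G) → Fin (n G) → List (Fin (n H))

  path : Fin (n G) → Fin (n G) → List (Fin (n H))
  path u v = φ u ∷ inner u v ++ [ φ v ]

  field
    path-is-path : ∀ u v → u < v → Adj G u v → Linked (Adj H) (path u v)
    inner-unique : ∀ u v → u < v → Adj G u v → Unique (inner u v)
    inner-new    : ∀ u v → u < v → Adj G u v →
                   ∀ x → x ∈ inner u v → ∀ w → φ w ≢ x
    inner-disj   : ∀ u v u′ v′ → u < v → Adj G u v → u′ < v′ → Adj G u′ v′ →
                   (u ≢ u′ ⊎ v ≢ v′) → ∀ x → x ∈ inner u v → x ∉ inner u′ v′
    cover-vertices : ∀ x → (∃[ w ] φ w ≡ x)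
                           ⊎ (∃[ u ] ∃[ v ] (u < v × Adj G u v × x ∈ inner u v))
    cover-edges  : ∀ x y → Adj H x y →
                   ∃[ u ] ∃[ v ] (u < v × Adj G u v
                                  × (Consec x y (path u v) ⊎ Consec y x (path u v)))

-- G is a minor of H: pairwise disjoint nonempty connected branch sets
-- B u = { x | branch x ≡ just u } in H, one for each vertex u of G, with an
-- edge of H between B u and B v whenever u v is an edge of G.
record MinorOf (G H : Graph) : Set where
  field
    branch    : Fin (n H) → Maybe (Fin (n G))
    nonempty  : ∀ u → ∃[ x ] branch x ≡ just u
    connected : ∀ u x y → branch x ≡ just u → branch y ≡ just u → x ≢ y →
                ∃[ ws ] (Linked (Adj H) (x ∷ ws ++ [ y ])
                         × All (λ z → branch z ≡ just u) ws)
    edges     : ∀ u v → Adj G u v →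
                ∃[ x ] ∃[ y ] (branch x ≡ just u × branch y ≡ just v × Adj H x y)

-- Give a vertex of level c and height e the label c² S² + 2e, with S huge.  Then
-- (c² S² + 2e)(c′² S² + 2e′) + 1 can only be a square if |e c′² − e′ c²| = c c′, and it is
-- one for two consecutive heights on the same level and for the heights 0 and e on the
-- levels b and e b.  Branch vertices w sit at height 0 on level B w; the edge u v (u < v)
-- is replaced by a path from u to v through the heights B v T, B v T − 1, …, B u T of the
-- level B u B v T, so consecutive vertices of each path are adjacent.  The parameters make
-- every other pair non-adjacent: distinct paths lie on levels too far apart, and a branch
-- vertex w can only attach to height e of such a path if e B w = B u B v T, which a
-- divisibility argument allows only at the two ends, for w = u and w = v.  Finally, any
-- subdivision of G has G as a minor.
module Submission where

open import Data.Bool using (true)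
import Data.Bool.Properties as Bool
open import Data.Fin as Fin using (Fin; toℕ; fromℕ<)
open import Data.Fin.Properties
  using (any?; toℕ<n; toℕ-fromℕ<; toℕ-injective; combine-injective; +↔⊎) renaming (<-cmp to Fin-<-cmp)
open import Data.List using (List; []; _∷_; _++_; [_]; tabulate)
open import Data.List.Membership.Propositional using (_∈_; _∉_)
open import Data.List.Membership.Propositional.Properties using (∈-tabulate⁺; ∈-tabulate⁻)
open import Data.List.Relation.Unary.All as All using (All; []; _∷_)
open import Data.List.Relation.Unary.Any using (here; there)
open import Data.List.Relation.Unary.Linked using (Linked; [-]; _∷_)
open import Data.List.Relation.Unary.Unique.Propositional.Properties using (tabulate⁺)
open import Data.Maybe using (Maybe; just; nothing)
open import Data.Nat
open import Data.Nat.Divisibility using (_∣_; divides; ∣-trans; m∣m*n; n∣m*n; ∣m+n∣m⇒∣n; ∣⇒≤; m≤n⇒m!∣n!)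
open import Data.Nat.Properties
open import Data.Nat.Tactic.RingSolver using (solve-∀)
open import Data.Product using (Σ; ∃; ∃-syntax; _×_; _,_; proj₁; proj₂; map₂)
open import Data.Product.Function.Dependent.Propositional using (Σ-↔)
open import Data.Sum as Sum using (_⊎_; inj₁; inj₂)
open import Data.Sum.Function.Propositional using (_⊎-↔_)
open import Data.Sum.Properties using (inj₁-injective; inj₂-injective)
open import Function using (_∘_; _$_; case_of_; Inverse; Equivalence; _↔_; _⇔_; mk⇔)
open import Function.Bundles using (mk↔ₛ′)
open import Function.Definitions using (Injective)
open import Function.Properties.Inverse using (↔-refl; ↔-trans)
open import Relation.Binary.Construct.Closure.ReflexiveTransitive as Star using (Star; ε; _◅_; _◅◅_)
open import Relation.Binary.Definitions using (Sym; tri<; tri≈; tri>)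
open import Relation.Binary.PropositionalEquality hiding ([_])
open import Relation.Nullary using (¬_; Dec; yes; no; does; contradiction)
open import Relation.Nullary.Decidable using (map′; _×-dec_; dec-true; dec-false)

open import Defs hiding (sym)

square-gap : ∀ X Y {d d′} → X * X + d ≡ Y * Y + d′ → d < X → d′ < X → d ≡ d′
square-gap X Y {d} {d′} eq d<X d′<X with <-cmp Y X
... | tri≈ _ refl _ = +-cancelˡ-≡ (X * X) d d′ eq
... | tri< Y<X _ _ = contradiction (+-cancelˡ-≤ (Y * Y) X d′ Y*Y+X≤) (<⇒≱ d′<X)
  where
  open ≤-Reasoning
  Y*Y+X≤ : Y * Y + X ≤ Y * Y + d′
  Y*Y+X≤ = begin
    Y * Y + X   ≡⟨ +-comm (Y * Y) X ⟩
    X + Y * Y   ≤⟨ +-monoʳ-≤ X (*-monoʳ-≤ Y (<⇒≤ Y<X)) ⟩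
    suc Y * X   ≤⟨ *-monoˡ-≤ X Y<X ⟩
    X * X       ≤⟨ m≤m+n (X * X) d ⟩
    X * X + d   ≡⟨ eq ⟩
    Y * Y + d′  ∎
... | tri> _ _ X<Y = contradiction (+-cancelˡ-≤ (X * X) X d X*X+X≤) (<⇒≱ d<X)
  where
  open ≤-Reasoning
  X*X+X≤ : X * X + X ≤ X * X + d
  X*X+X≤ = begin
    X * X + X   ≡⟨ +-comm (X * X) X ⟩
    suc X * X   ≤⟨ *-monoʳ-≤ (suc X) (<⇒≤ X<Y) ⟩
    suc X * Y   ≤⟨ *-monoˡ-≤ Y X<Y ⟩
    Y * Y       ≤⟨ m≤m+n (Y * Y) d′ ⟩
    Y * Y + d′  ≡⟨ sym eq ⟩
    X * X + d   ∎

square-injective : ∀ {a b} → a * a ≡ b * b → a ≡ b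
square-injective {a} {b} eq with <-cmp a b
... | tri≈ _ a≡b _ = a≡b
... | tri< a<b _ _ = contradiction eq (<⇒≢ (*-mono-< a<b a<b))
... | tri> _ _ b<a = contradiction (sym eq) (<⇒≢ (*-mono-< b<a b<a))

difference-of-squares-≤ : ∀ {α β γ} → β ≤ α → (α + β) * (α + β) ≡ 4 * α * β + γ * γ → α ≡ β + γ
difference-of-squares-≤ {β = β} {γ} β≤α eq with m≤n⇒∃[o]m+o≡n β≤α
... | δ , refl = cong (β +_) (square-injective (+-cancelˡ-≡ (4 * (β + δ) * β) _ _ δ²≡γ²))
  where
  expand : ∀ β δ → (β + δ + β) * (β + δ + β) ≡ 4 * (β + δ) * β + δ * δ
  expand = solve-∀
  δ²≡γ² : 4 * (β + δ) * β + δ * δ ≡ 4 * (β + δ) * β + γ * γ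
  δ²≡γ² = trans (sym (expand β δ)) eq

difference-of-squares : ∀ α β γ → (α + β) * (α + β) ≡ 4 * α * β + γ * γ →
                        α ≡ β + γ ⊎ β ≡ α + γ
difference-of-squares α β γ eq with ≤-total β α
... | inj₁ β≤α = inj₁ (difference-of-squares-≤ β≤α eq)
... | inj₂ α≤β = inj₂ (difference-of-squares-≤ α≤β (trans (swap β α) (trans eq (cong (_+ γ * γ) (swap′ α β)))))
  where
  swap : ∀ β α → (β + α) * (β + α) ≡ (α + β) * (α + β)
  swap = solve-∀
  swap′ : ∀ α β → 4 * α * β ≡ 4 * β * α
  swap′ = solve-∀

dec-true⁻ : ∀ {P : Set} (p? : Dec P) → does p? ≡ true → P
dec-true⁻ (yes p) _ = p

n≤n*n : ∀ n → n ≤ n * n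
n≤n*n zero    = z≤n
n≤n*n (suc n) = m≤m*n (suc n) (suc n)

isSquare? : ∀ m → Dec (IsSquare m)
isSquare? m = map′ (λ (k , m≡k²) → toℕ k , m≡k²) root< (any? λ k → m ≟ toℕ k * toℕ k)
  where
  root< : IsSquare m → ∃[ k ] m ≡ toℕ {suc m} k * toℕ k
  root< (k , refl) = fromℕ< (s≤s (n≤n*n k)) , cong (λ i → i * i) (sym (toℕ-fromℕ< (s≤s (n≤n*n k))))

n*n+1-nonsquare : ∀ {n} → 0 < n → ¬ IsSquare (n * n + 1)
n*n+1-nonsquare {n} 0<n (k , eq) with ≤-<-connex k n
... | inj₁ k≤n = <-irrefl (sym eq) (≤-<-trans (*-mono-≤ k≤n k≤n) (m<m+n (n * n) z<s))
... | inj₂ n<k = <-irrefl eq (begin-strict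
    n * n + 1           <⟨ +-monoʳ-< (n * n) (≤-trans (s≤s 0<n) (m≤m+n (suc n) n)) ⟩
    n * n + (1 + n + n) ≡⟨ expand n ⟩
    suc n * suc n       ≤⟨ *-mono-≤ n<k n<k ⟩
    k * k               ∎)
  where
  open ≤-Reasoning
  expand : ∀ n → n * n + (1 + n + n) ≡ suc n * suc n
  expand = solve-∀

isSquare-comm : ∀ a b → IsSquare (a * b + 1) → IsSquare (b * a + 1)
isSquare-comm a b = subst (λ m → IsSquare (m + 1)) (*-comm a b)

data Balanced (c e c′ e′ : ℕ) : Set where
  left  : e * (c′ * c′) ≡ e′ * (c * c) + c * c′ → Balanced c e c′ e′
  right : e′ * (c * c) ≡ e * (c′ * c′) + c * c′ → Balanced c e c′ e′

label : ℕ → ℕ → ℕ → ℕ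
label S c e = c * c * (S * S) + 2 * e

-- With P = c c′ and q = e c′² + e′ c², P² (label·label′ + 1) + q² = X² + P² (4 e e′ + 1) for
-- X = P² S² + q, and both P² (4 e e′ + 1) and q² are below X.  So if label·label′ + 1 = k², then
-- q² = P² (4 e e′ + 1), that is (e c′² − e′ c²)² = P².
label-square⇒balanced : ∀ S {c e c′ e′} → 0 < c → 0 < c′ →
                        e * (c′ * c′) + e′ * (c * c) < S → 4 * e * e′ + 1 < S * S →
                        IsSquare (label S c e * label S c′ e′ + 1) → Balanced c e c′ e′
label-square⇒balanced S {c} {e} {c′} {e′} 0<c 0<c′ q<S 4ee′+1<S² (k , square) =
  Sum.[ left , right ]′ $
    difference-of-squares (e * (c′ * c′)) (e′ * (c * c)) P (trans (sym gap≡q²) (regroup e e′ c c′))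
  where
  P = c * c′
  q = e * (c′ * c′) + e′ * (c * c)
  X = P * P * (S * S) + q
  gap = P * P * (4 * e * e′ + 1)
  instance
    P²-nonZero : NonZero (P * P)
    P²-nonZero = >-nonZero (*-mono-< (*-mono-< 0<c 0<c′) (*-mono-< 0<c 0<c′))
  identity : ∀ S c e c′ e′ →
    (c * c′) * (c * c′) * ((c * c * (S * S) + 2 * e) * (c′ * c′ * (S * S) + 2 * e′) + 1)
      + (e * (c′ * c′) + e′ * (c * c)) * (e * (c′ * c′) + e′ * (c * c))
    ≡ ((c * c′) * (c * c′) * (S * S) + (e * (c′ * c′) + e′ * (c * c)))
        * ((c * c′) * (c * c′) * (S * S) + (e * (c′ * c′) + e′ * (c * c)))
      + (c * c′) * (c * c′) * (4 * e * e′ + 1)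
  identity = solve-∀
  square-product : ∀ P k → P * P * (k * k) ≡ (P * k) * (P * k)
  square-product = solve-∀
  regroup : ∀ e e′ c c′ → (c * c′) * (c * c′) * (4 * e * e′ + 1)
                        ≡ 4 * (e * (c′ * c′)) * (e′ * (c * c)) + (c * c′) * (c * c′)
  regroup = solve-∀
  completed : X * X + gap ≡ (P * k) * (P * k) + q * q
  completed = begin
    X * X + gap                                        ≡⟨ identity S c e c′ e′ ⟨
    P * P * (label S c e * label S c′ e′ + 1) + q * q  ≡⟨ cong (λ m → P * P * m + q * q) square ⟩
    P * P * (k * k) + q * q                            ≡⟨ cong (_+ q * q) (square-product P k) ⟩
    (P * k) * (P * k) + q * q                          ∎
    where open ≡-Reasoning
  gap<X : gap < X
  gap<X = <-≤-trans (*-monoʳ-< (P * P) 4ee′+1<S²) (m≤m+n _ q)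
  q²<X : q * q < X
  q²<X = <-≤-trans (*-mono-< q<S q<S) (≤-trans (m≤n*m (S * S) (P * P)) (m≤m+n _ q))
  gap≡q² : gap ≡ q * q
  gap≡q² = square-gap X (P * k) completed gap<X q²<X

label-<-level : ∀ S {c c′} e e′ → c < c′ → 2 * e < S * S → label S c e < label S c′ e′
label-<-level S {c} {c′} e e′ c<c′ 2e<S² = begin-strict
  c * c * (S * S) + 2 * e   <⟨ +-monoʳ-< (c * c * (S * S)) 2e<S² ⟩
  c * c * (S * S) + S * S   ≡⟨ +-comm (c * c * (S * S)) (S * S) ⟩
  suc (c * c) * (S * S)     ≤⟨ *-monoˡ-≤ (S * S) (*-mono-< c<c′ c<c′) ⟩
  c′ * c′ * (S * S)         ≤⟨ m≤m+n _ (2 * e′) ⟩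
  label S c′ e′             ∎
  where open ≤-Reasoning

label-injective : ∀ S {c e c′ e′} → 2 * e < S * S → 2 * e′ < S * S →
                  label S c e ≡ label S c′ e′ → c ≡ c′ × e ≡ e′
label-injective S {c} {e} {c′} {e′} 2e<S² 2e′<S² eq with <-cmp c c′
... | tri< c<c′ _ _ = contradiction eq (<⇒≢ (label-<-level S e e′ c<c′ 2e<S²))
... | tri> _ _ c′<c = contradiction (sym eq) (<⇒≢ (label-<-level S e′ e c′<c 2e′<S²))
... | tri≈ _ refl _ = refl , *-cancelˡ-≡ e e′ 2 (+-cancelˡ-≡ (c * c * (S * S)) _ _ eq)

label-pos : ∀ {S c} e → 0 < S → 0 < c → 0 < label S c e
label-pos e 0<S 0<c = <-≤-trans (*-mono-< (*-mono-< 0<c 0<c) (*-mono-< 0<S 0<S)) (m≤m+n _ (2 * e))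

label-suc-square : ∀ S c e → IsSquare (label S c (suc e) * label S c e + 1)
label-suc-square S c e = label S c e + 1 , expand (c * c * (S * S)) e
  where
  expand : ∀ A e → (A + 2 * suc e) * (A + 2 * e) + 1 ≡ (A + 2 * e + 1) * (A + 2 * e + 1)
  expand = solve-∀

label-multiple-square : ∀ S b e → IsSquare (label S b 0 * label S (e * b) e + 1)
label-multiple-square S b e = e * b * b * (S * S) + 1 , expand S b e
  where
  expand : ∀ S b e → (b * b * (S * S) + 2 * 0) * ((e * b) * (e * b) * (S * S) + 2 * e) + 1
                   ≡ (e * b * b * (S * S) + 1) * (e * b * b * (S * S) + 1)
  expand = solve-∀

balanced-sym : ∀ {c e c′ e′} → Balanced c e c′ e′ → Balanced c′ e′ c e
balanced-sym {c} {e} {c′} {e′} (left eq)  = right (trans eq (cong (e′ * (c * c) +_) (*-comm c c′)))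
balanced-sym {c} {e} {c′} {e′} (right eq) = left (trans eq (cong (e * (c′ * c′) +_) (*-comm c c′)))

m*o≡n*o+o⇒m≡1+n : ∀ {m n o} → 0 < o → m * o ≡ n * o + o → m ≡ suc n
m*o≡n*o+o⇒m≡1+n {m} {n} {o} 0<o eq = *-cancelʳ-≡ m (suc n) o ⦃ >-nonZero 0<o ⦄ (trans eq (+-comm (n * o) o))

balanced-same-level : ∀ {c e e′} → 0 < c → Balanced c e c e′ → e ≡ suc e′ ⊎ e′ ≡ suc e
balanced-same-level 0<c (left eq)  = inj₁ (m*o≡n*o+o⇒m≡1+n (*-mono-< 0<c 0<c) eq)
balanced-same-level 0<c (right eq) = inj₂ (m*o≡n*o+o⇒m≡1+n (*-mono-< 0<c 0<c) eq)

¬balanced-0-0 : ∀ {c c′} → 0 < c → 0 < c′ → ¬ Balanced c 0 c′ 0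
¬balanced-0-0 0<c 0<c′ (left eq)  = <⇒≢ (*-mono-< 0<c 0<c′) eq
¬balanced-0-0 0<c 0<c′ (right eq) = <⇒≢ (*-mono-< 0<c 0<c′) eq

balanced-0⇒divides : ∀ {b c e} → 0 < b → 0 < c → Balanced b 0 c e → e * b ≡ c
balanced-0⇒divides {b} {c} {e} 0<b 0<c (left 0≡) =
  contradiction 0≡ (<⇒≢ (<-≤-trans (*-mono-< 0<b 0<c) (m≤n+m (b * c) (e * (b * b)))))
balanced-0⇒divides {b} {c} {e} 0<b 0<c (right eq) = *-cancelʳ-≡ (e * b) c b $ begin
  e * b * b     ≡⟨ *-assoc e b b ⟩
  e * (b * b)   ≡⟨ eq ⟩
  b * c         ≡⟨ *-comm b c ⟩
  c * b         ∎
  where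
  open ≡-Reasoning
  instance
    b-nonZero : NonZero b
    b-nonZero = >-nonZero 0<b

¬balanced-apart : ∀ {K c e c′ e′} → 0 < c → 0 < c′ → K * (c + 1) < c′ → c ≤ K * e → e′ ≤ c′ →
                  ¬ Balanced c e c′ e′
¬balanced-apart {K} {c} {e} {c′} {e′} 0<c 0<c′ apart c≤Ke e′≤c′ balanced = case balanced of λ where
    (left eq)  → <-irrefl (sym eq) lower<upper
    (right eq) → <-irrefl refl (begin-strict
      e′ * (c * c)                 ≤⟨ m≤m+n _ (c * c′) ⟩
      e′ * (c * c) + c * c′        <⟨ lower<upper ⟩
      e * (c′ * c′)                ≤⟨ m≤m+n _ (c * c′) ⟩
      e * (c′ * c′) + c * c′       ≡⟨ eq ⟨
      e′ * (c * c)                 ∎)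
  where
  open ≤-Reasoning
  regroup : ∀ K c c′ → K * (c′ * (c * c) + c * c′) ≡ (c * c′) * (K * (c + 1))
  regroup = solve-∀
  lower<upper : e′ * (c * c) + c * c′ < e * (c′ * c′)
  lower<upper = *-cancelˡ-< K _ _ (begin-strict
    K * (e′ * (c * c) + c * c′)  ≤⟨ *-monoʳ-≤ K (+-monoˡ-≤ (c * c′) (*-monoˡ-≤ (c * c) e′≤c′)) ⟩
    K * (c′ * (c * c) + c * c′)  ≡⟨ regroup K c c′ ⟩
    (c * c′) * (K * (c + 1))     <⟨ *-monoʳ-< (c * c′) ⦃ >-nonZero (*-mono-< 0<c 0<c′) ⦄ apart ⟩
    (c * c′) * c′                ≡⟨ *-assoc c c′ c′ ⟩
    c * (c′ * c′)                ≤⟨ *-monoˡ-≤ (c′ * c′) c≤Ke ⟩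
    K * e * (c′ * c′)            ≡⟨ *-assoc K e (c′ * c′) ⟩
    K * (e * (c′ * c′))          ∎)

scale : ℕ → ℕ
scale Z = 4 * (suc Z * (suc Z * suc Z))

module _ {Z : ℕ} where
  private
    W = suc Z
    S = scale Z

  0<scale : 0 < scale Z
  0<scale = *-mono-< {0} {4} z<s (*-mono-< 0<W (*-mono-< 0<W 0<W))
    where
    0<W : 0 < W
    0<W = z<s

  private
    S≤S² : S ≤ S * S
    S≤S² = m≤m*n S S ⦃ >-nonZero 0<scale ⦄

  open ≤-Reasoning

  cross-terms<scale : ∀ {c e c′ e′} → c ≤ Z → e ≤ Z → c′ ≤ Z → e′ ≤ Z →
                      e * (c′ * c′) + e′ * (c * c) < scale Z
  cross-terms<scale {c} {e} {c′} {e′} c≤Z e≤Z c′≤Z e′≤Z = begin-strict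
    e * (c′ * c′) + e′ * (c * c)  <⟨ +-mono-< (cube< e≤Z c′≤Z) (cube< e′≤Z c≤Z) ⟩
    W * (W * W) + W * (W * W)     ≤⟨ +-monoʳ-≤ (W * (W * W)) (m≤m+n _ _) ⟩
    4 * (W * (W * W))             ∎
    where
    cube< : ∀ {x y} → x ≤ Z → y ≤ Z → x * (y * y) < W * (W * W)
    cube< x≤Z y≤Z = *-mono-< (s≤s x≤Z) (*-mono-< (s≤s y≤Z) (s≤s y≤Z))

  4ee′+1<scale² : ∀ {e e′} → e ≤ Z → e′ ≤ Z → 4 * e * e′ + 1 < scale Z * scale Z
  4ee′+1<scale² {e} {e′} e≤Z e′≤Z = begin-strict
    4 * e * e′ + 1      ≡⟨ cong (_+ 1) (*-assoc 4 e e′) ⟩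
    4 * (e * e′) + 1    <⟨ +-monoʳ-< (4 * (e * e′)) (s≤s (s≤s z≤n)) ⟩
    4 * (e * e′) + 4    ≡⟨ *-distribˡ-+ 4 (e * e′) 1 ⟨
    4 * (e * e′ + 1)    ≡⟨ cong (4 *_) (+-comm (e * e′) 1) ⟩
    4 * (1 + e * e′)    ≤⟨ *-monoʳ-≤ 4 (*-mono-< (s≤s e≤Z) (s≤s e′≤Z)) ⟩
    4 * (W * W)         ≤⟨ *-monoʳ-≤ 4 (m≤n*m (W * W) W) ⟩
    S                   ≤⟨ S≤S² ⟩
    S * S               ∎

  2e<scale² : ∀ {e} → e ≤ Z → 2 * e < scale Z * scale Z
  2e<scale² {e} e≤Z = begin-strict
    2 * e               ≤⟨ *-monoʳ-≤ 2 e≤Z ⟩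
    2 * Z               <⟨ *-monoʳ-< 2 (n<1+n Z) ⟩
    2 * W               ≤⟨ *-monoˡ-≤ W {2} {4} (s≤s (s≤s z≤n)) ⟩
    4 * W               ≤⟨ *-monoʳ-≤ 4 (m≤m*n W (W * W)) ⟩
    S                   ≤⟨ S≤S² ⟩
    S * S               ∎

  small-label-square⇒balanced : ∀ {c e c′ e′} → 0 < c → 0 < c′ → c ≤ Z → e ≤ Z → c′ ≤ Z → e′ ≤ Z →
                                IsSquare (label (scale Z) c e * label (scale Z) c′ e′ + 1) →
                                Balanced c e c′ e′
  small-label-square⇒balanced {c} {e} {c′} {e′} 0<c 0<c′ c≤Z e≤Z c′≤Z e′≤Z =
    label-square⇒balanced S {c} {e} {c′} {e′} 0<c 0<c′
      (cross-terms<scale c≤Z e≤Z c′≤Z e′≤Z) (4ee′+1<scale² e≤Z e′≤Z)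

  small-label-injective : ∀ {c e c′ e′} → e ≤ Z → e′ ≤ Z →
                          label (scale Z) c e ≡ label (scale Z) c′ e′ → c ≡ c′ × e ≡ e′
  small-label-injective e≤Z e′≤Z = label-injective S (2e<scale² e≤Z) (2e<scale² e′≤Z)

Inside : {A : Set} → (A → Set) → (A → A → Set) → A → A → Set
Inside P R a b = P a × P b × R a b

module _ {A : Set} {P : A → Set} {R : A → A → Set} where

  linked-prefix : ∀ {a xs ys x} → Linked R (a ∷ xs ++ ys) → P a → All P xs → x ∈ xs →
                  Star (Inside P R) a x
  linked-prefix {xs = z ∷ zs} (r ∷ linked) pa (pz ∷ pzs) (here refl) = (pa , pz , r) ◅ ε
  linked-prefix {xs = z ∷ zs} (r ∷ linked) pa (pz ∷ pzs) (there x∈zs) =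
    (pa , pz , r) ◅ linked-prefix linked pz pzs x∈zs

  linked-last : ∀ {a xs b} → Linked R (a ∷ xs ++ [ b ]) → P a → All P xs → ∃[ x ] P x × R x b
  linked-last {a} {[]}     (r ∷ [-])    pa []         = a , pa , r
  linked-last {a} {z ∷ zs} (r ∷ linked) pa (pz ∷ pzs) = linked-last linked pz pzs

  star⇒linked : ∀ {x y} → Star (Inside P R) x y → x ≢ y →
                ∃[ ws ] Linked R (x ∷ ws ++ [ y ]) × All P ws
  star⇒linked ε x≢x = contradiction refl x≢x
  star⇒linked (step ◅ steps) _ = plus⇒linked step steps
    where
    plus⇒linked : ∀ {x z y} → Inside P R x z → Star (Inside P R) z y →
                  ∃[ ws ] Linked R (x ∷ ws ++ [ y ]) × All P ws
    plus⇒linked (_ , _ , r) ε = [] , r ∷ [-] , []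
    plus⇒linked {z = z} (_ , pz , r) (step ◅ steps) with plus⇒linked step steps
    ... | ws , linked , pws = z ∷ ws , r ∷ linked , pz ∷ pws

module _ {A : Set} where

  consec-first : ∀ {m} (g : Fin m → A) {a ys} j → toℕ j ≡ 0 → Consec a (g j) (a ∷ tabulate g ++ ys)
  consec-first {suc m} g Fin.zero _ = here

  consec-step : ∀ {m} (g : Fin m → A) {ys} j j′ → toℕ j′ ≡ suc (toℕ j) →
                Consec (g j) (g j′) (tabulate g ++ ys)
  consec-step g Fin.zero    (Fin.suc Fin.zero)    _  = here
  consec-step g Fin.zero    (Fin.suc (Fin.suc _)) ()
  consec-step g (Fin.suc j) (Fin.suc j′)          eq = there (consec-step (g ∘ Fin.suc) j j′ (suc-injective eq))

  consec-last : ∀ {m} (g : Fin m → A) {b} j → suc (toℕ j) ≡ m → Consec (g j) b (tabulate g ++ [ b ])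
  consec-last {suc zero}    g Fin.zero    _  = here
  consec-last {suc (suc m)} g (Fin.suc j) eq = there (consec-last (g ∘ Fin.suc) j (suc-injective eq))

  linked-tabulate : ∀ {R : A → A → Set} {m} (g : Fin m → A) {a b} →
                    (m ≡ 0 → R a b) →
                    (∀ j → toℕ j ≡ 0 → R a (g j)) →
                    (∀ j j′ → toℕ j′ ≡ suc (toℕ j) → R (g j) (g j′)) →
                    (∀ j → suc (toℕ j) ≡ m → R (g j) b) →
                    Linked R (a ∷ tabulate g ++ [ b ])
  linked-tabulate {m = zero}  g empty first step last = empty refl ∷ [-]
  linked-tabulate {m = suc m} g empty first step last =
    first Fin.zero refl ∷ linked-tabulate (g ∘ Fin.suc)
      (λ m≡0 → last Fin.zero (cong suc (sym m≡0)))
      (λ j j≡0 → step Fin.zero (Fin.suc j) (cong suc j≡0))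
      (λ j j′ eq → step (Fin.suc j) (Fin.suc j′) (cong suc eq))
      (λ j eq → last (Fin.suc j) (cong suc eq))

Edge : (G : Graph) → Fin (n G) → Fin (n G) → Set
Edge G u v = u Fin.< v × Adj G u v

edge? : ∀ G u v → Dec (Edge G u v)
edge? G u v = (u Fin.<? v) ×-dec (adj G u v Bool.≟ true)

module _ {H G : Graph} (sub : SubdivisionOf H G) where
  open SubdivisionOf sub
  open import Data.List.Membership.DecPropositional (Fin._≟_ {n H}) using (_∈?_)

  private
    IsBranch IsInner : Fin (n H) → Set
    IsBranch x = ∃[ w ] φ w ≡ x
    IsInner  x = ∃[ u ] ∃[ v ] Edge G u v × x ∈ inner u v

    owner : ∀ {x} → Dec (IsBranch x) → Dec (IsInner x) → Maybe (Fin (n G))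
    owner (yes (w , _)) _             = just w
    owner (no _)        (yes (u , _)) = just u
    owner (no _)        (no _)        = nothing

    owner-φ : ∀ w (b? : Dec (IsBranch (φ w))) i? → owner b? i? ≡ just w
    owner-φ w (yes (w′ , φw′≡φw)) _ = cong just (φ-inj φw′≡φw)
    owner-φ w (no ¬branch)        _ = contradiction (w , refl) ¬branch

    owner-inner : ∀ {u v x} → Edge G u v → x ∈ inner u v →
                  (b? : Dec (IsBranch x)) (i? : Dec (IsInner x)) → owner b? i? ≡ just u
    owner-inner (u<v , uv) x∈ (yes (w , φw≡x)) _ = contradiction φw≡x (inner-new _ _ u<v uv _ x∈ w)
    owner-inner {u} {v} {x} (u<v , uv) x∈ (no _) (yes (u′ , v′ , (u′<v′ , u′v′) , x∈′))
      with u′ Fin.≟ u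
    ... | yes u′≡u = cong just u′≡u
    ... | no u′≢u  = contradiction x∈′ (inner-disj u v u′ v′ u<v uv u′<v′ u′v′ (inj₁ (u′≢u ∘ sym)) x x∈)
    owner-inner {u} {v} edge x∈ (no _) (no ¬inner) = contradiction (u , v , edge , x∈) ¬inner

    owner⁻ : ∀ {u x} (b? : Dec (IsBranch x)) (i? : Dec (IsInner x)) → owner b? i? ≡ just u →
             φ u ≡ x ⊎ ∃[ v ] Edge G u v × x ∈ inner u v
    owner⁻ (yes (w , φw≡x)) _                          refl = inj₁ φw≡x
    owner⁻ (no _)           (yes (u , v , edge , x∈)) refl = inj₂ (v , edge , x∈)

  -- The branch set of u consists of φ u and the inner vertices of the paths replacing the
  -- edges u v with u < v.
  branch : Fin (n H) → Maybe (Fin (n G))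
  branch x = owner (any? λ w → φ w Fin.≟ x)
                   (any? λ u → any? λ v → edge? G u v ×-dec (x ∈? inner u v))

  private
    branch-φ : ∀ w → branch (φ w) ≡ just w
    branch-φ w = owner-φ w _ _

    InBranch : Fin (n G) → Fin (n H) → Set
    InBranch u x = branch x ≡ just u

    inner-in-branch : ∀ {u v} → Edge G u v → All (InBranch u) (inner u v)
    inner-in-branch edge = All.tabulate λ x∈ → owner-inner edge x∈ _ _

    reach : ∀ {u x} → InBranch u x → Star (Inside (InBranch u) (Adj H)) (φ u) x
    reach {u} {x} bx with owner⁻ _ _ bx
    ... | inj₁ refl = ε
    ... | inj₂ (v , edge@(u<v , uv) , x∈) =
      linked-prefix (path-is-path u v u<v uv) (branch-φ u) (inner-in-branch edge) x∈

    flip : ∀ {u} → Sym (Inside (InBranch u) (Adj H)) (Inside (InBranch u) (Adj H))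
    flip (bx , by , xy) = by , bx , trans (Graph.sym H _ _) xy

    edge-into : ∀ {u v} → Edge G u v → ∃[ x ] InBranch u x × Adj H x (φ v)
    edge-into {u} {v} edge@(u<v , uv) =
      linked-last (path-is-path u v u<v uv) (branch-φ u) (inner-in-branch edge)

  subdivision⇒minor : MinorOf G H
  subdivision⇒minor = record
    { branch    = branch
    ; nonempty  = λ u → φ u , branch-φ u
    ; connected = λ u x y bx by x≢y →
        star⇒linked (Star.reverse flip (reach bx) ◅◅ reach by) x≢y
    ; edges     = edges
    }
    where
    edges : ∀ u v → Adj G u v → ∃[ x ] ∃[ y ] InBranch u x × InBranch v y × Adj H x y
    edges u v uv with Fin-<-cmp u v
    ... | tri< u<v _ _ = let x , bx , xv = edge-into (u<v , uv) in x , φ v , bx , branch-φ v , xv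
    ... | tri> _ _ v<u = let y , by , yu = edge-into (v<u , trans (Graph.sym G v u) uv)
                         in φ u , y , branch-φ u , by , trans (Graph.sym H _ _) yu
    ... | tri≈ _ refl _ = contradiction (trans (sym uv) (irrefl G u)) λ ()

module DiophantineGraph {A : Set} {m : ℕ} (enum : Fin m ↔ A) (ℓ : A → ℕ) (ℓ-pos : ∀ a → 0 < ℓ a) where
  open Inverse enum using (to; from; strictlyInverseˡ; strictlyInverseʳ)

  graph : Graph
  graph = record
    { n      = m
    ; adj    = λ x y → does (isSquare? (ℓ (to x) * ℓ (to y) + 1))
    ; sym    = λ x y → cong (λ k → does (isSquare? (k + 1))) (*-comm (ℓ (to x)) (ℓ (to y)))
    ; irrefl = λ x → dec-false (isSquare? _) (n*n+1-nonsquare (ℓ-pos (to x)))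
    }

  private
    adj⇔square′ : ∀ {x y} → Adj graph x y ⇔ IsSquare (ℓ (to x) * ℓ (to y) + 1)
    adj⇔square′ = mk⇔ (dec-true⁻ (isSquare? _)) (dec-true (isSquare? _))

  adj⇔square : ∀ a b → Adj graph (from a) (from b) ⇔ IsSquare (ℓ a * ℓ b + 1)
  adj⇔square a b = subst₂ (λ a′ b′ → Adj graph (from a) (from b) ⇔ IsSquare (ℓ a′ * ℓ b′ + 1))
    (strictlyInverseˡ a) (strictlyInverseˡ b) adj⇔square′

  graph-diophantine : Injective _≡_ _≡_ ℓ → IsDiophantine graph
  graph-diophantine ℓ-inj =
      ℓ ∘ to
    , (λ eq → trans (sym (strictlyInverseʳ _)) (trans (cong from (ℓ-inj eq)) (strictlyInverseʳ _)))
    , ℓ-pos ∘ to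
    , λ x y _ → adj⇔square′

∑ : ∀ m → (Fin m → ℕ) → ℕ
∑ zero    f = 0
∑ (suc m) f = f Fin.zero + ∑ m (f ∘ Fin.suc)

⊎↔Σ-suc : ∀ {m} (P : Fin (suc m) → Set) → (P Fin.zero ⊎ Σ (Fin m) (P ∘ Fin.suc)) ↔ Σ (Fin (suc m)) P
⊎↔Σ-suc P = mk↔ₛ′ to from to∘from from∘to
  where
  to : _ ⊎ Σ _ _ → Σ _ P
  to (inj₁ p)       = Fin.zero , p
  to (inj₂ (i , p)) = Fin.suc i , p
  from : Σ _ P → _ ⊎ Σ _ _
  from (Fin.zero  , p) = inj₁ p
  from (Fin.suc i , p) = inj₂ (i , p)
  to∘from : ∀ x → to (from x) ≡ x
  to∘from (Fin.zero  , p) = refl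
  to∘from (Fin.suc i , p) = refl
  from∘to : ∀ x → from (to x) ≡ x
  from∘to (inj₁ p) = refl
  from∘to (inj₂ _) = refl

Fin-∑↔Σ : ∀ m (f : Fin m → ℕ) → Fin (∑ m f) ↔ Σ (Fin m) (Fin ∘ f)
Fin-∑↔Σ zero    f = mk↔ₛ′ (λ ()) (λ ()) (λ ()) (λ ())
Fin-∑↔Σ (suc m) f = ↔-trans +↔⊎ (↔-trans (↔-refl ⊎-↔ Fin-∑↔Σ m (f ∘ Fin.suc)) (⊎↔Σ-suc (Fin ∘ f)))

-- Branch vertex a gets level B a.  The inner vertices of the path replacing the edge u v get
-- level C u v and the heights B v * T u v − j for j = 0, 1, …, D u v, descending to B u * T u v.
-- L is divisible by every B a, so T u v ≡ 1 modulo each of them, and the powers of Q make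
-- distinct levels C differ by more than the factor K.
module Parameters (N : ℕ) where

  M : ℕ
  M = N * N + 2

  B : ℕ → ℕ
  B a = M + a

  K : ℕ
  K = M + N

  L : ℕ
  L = K !

  Q : ℕ
  Q = 2 * (K * K * K) + K

  T : Fin N → Fin N → ℕ
  T u v = 1 + L * Q ^ toℕ (Fin.combine u v)

  C : Fin N → Fin N → ℕ
  C u v = B (toℕ u) * B (toℕ v) * T u v

  D : Fin N → Fin N → ℕ
  D u v = (toℕ v ∸ toℕ u) * T u v

  height : Fin N → Fin N → ℕ → ℕ
  height u v j = B (toℕ v) * T u v ∸ j

  Z : ℕ
  Z = K * K * (1 + L * Q ^ (N * N))

  2≤M : 2 ≤ M
  2≤M = m≤n+m 2 (N * N)

  0<B : ∀ a → 0 < B a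
  0<B a = ≤-trans (s≤s z≤n) (≤-trans 2≤M (m≤m+n M a))

  0<K : 0 < K
  0<K = 0<B N

  B≤K : ∀ {a} → a < N → B a ≤ K
  B≤K a<N = +-monoʳ-≤ M (<⇒≤ a<N)

  B∣L : ∀ {a} → a < N → B a ∣ L
  B∣L {a} a<N = ∣-trans (n∣n! (B a) (0<B a)) (m≤n⇒m!∣n! (B≤K a<N))
    where
    n∣n! : ∀ n → 0 < n → n ∣ n !
    n∣n! (suc n) _ = m∣m*n (n !)

  -- Modulo B c we have T ≡ 1 and B a * B b ≡ −(c − a)(b − c), where 0 < (c − a)(b − c) < B c.
  ¬B∣B*B*T : ∀ {a b c} s → a < c → c < b → b < N → ¬ (B c ∣ B a * B b * (1 + L * s))
  ¬B∣B*B*T {a} {b} {c} s a<c c<b b<N B∣ with m≤n⇒∃[o]m+o≡n a<c | m≤n⇒∃[o]m+o≡n c<b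
  ... | α′ , refl | β′ , refl = contradiction (∣⇒≤ ⦃ >-nonZero 0<αβ ⦄ B∣αβ) (<⇒≱ αβ<B)
    where
    α = suc α′
    β = suc β′
    0<αβ : 0 < α * β
    0<αβ = *-mono-< {0} {α} {0} {β} z<s z<s
    αβ<B : α * β < B c
    αβ<B = begin-strict
      α * β   <⟨ *-mono-< (≤-<-trans (s≤s (m≤n+m α′ a)) (<-trans c<b b<N)) (≤-<-trans (s≤s (m≤n+m β′ c)) b<N) ⟩
      N * N   <⟨ m<m+n (N * N) z<s ⟩
      M       ≤⟨ m≤m+n M c ⟩
      B c     ∎
      where open ≤-Reasoning
    split : B a * B b * (1 + L * s) ≡ B a * B b * (L * s) + B a * B b
    split = expand (B a * B b) (L * s)
      where
      expand : ∀ x y → x * (1 + y) ≡ x * y + x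
      expand = solve-∀
    B∣BB : B c ∣ B a * B b
    B∣BB = ∣m+n∣m⇒∣n (subst (B c ∣_) split B∣)
                      (∣-trans (B∣L (<-trans c<b b<N)) (∣-trans (m∣m*n s) (n∣m*n (B a * B b))))
    identity : ∀ M a α′ β′ → (M + a) * (M + suc (suc (a + α′ + β′))) + suc α′ * suc β′
                           ≡ (M + suc (a + α′)) * (M + a + suc β′)
    identity = solve-∀
    B∣αβ : B c ∣ α * β
    B∣αβ = ∣m+n∣m⇒∣n (subst (B c ∣_) (sym (identity M a α′ β′)) (m∣m*n (B a + β))) B∣BB

  private
    rotate : ∀ x y t → x * y * t ≡ y * t * x
    rotate = solve-∀
    rotate′ : ∀ x y t → x * y * t ≡ x * t * y
    rotate′ = solve-∀

  B-cofactor-at-ends : ∀ {a b c e} s → a < b → b < N → B a * (1 + L * s) ≤ e → e ≤ B b * (1 + L * s) →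
               e * B c ≡ B a * B b * (1 + L * s) →
               c ≡ a × e ≡ B b * (1 + L * s) ⊎ c ≡ b × e ≡ B a * (1 + L * s)
  B-cofactor-at-ends {a} {b} {c} {e} s a<b b<N lower upper eq with <-cmp c a | <-cmp c b
  ... | tri< c<a _ _ | _ = contradiction eq (<⇒≢ (begin-strict
      e * B c                 ≤⟨ *-monoˡ-≤ (B c) upper ⟩
      B b * (1 + L * s) * B c <⟨ *-monoʳ-< (B b * (1 + L * s)) ⦃ >-nonZero (*-mono-< (0<B b) z<s) ⦄ (+-monoʳ-< M c<a) ⟩
      B b * (1 + L * s) * B a ≡⟨ rotate (B a) (B b) (1 + L * s) ⟨
      B a * B b * (1 + L * s) ∎))
    where open ≤-Reasoning
  ... | tri≈ _ refl _ | _ = inj₁ (refl , *-cancelʳ-≡ e (B b * (1 + L * s)) (B a) ⦃ >-nonZero (0<B a) ⦄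
                                          (trans eq (rotate (B a) (B b) (1 + L * s))))
  ... | tri> _ _ a<c | tri< c<b _ _ = contradiction (divides e (sym eq)) (¬B∣B*B*T s a<c c<b b<N)
  ... | _ | tri≈ _ refl _ = inj₂ (refl , *-cancelʳ-≡ e (B a * (1 + L * s)) (B b) ⦃ >-nonZero (0<B b) ⦄
                                          (trans eq (rotate′ (B a) (B b) (1 + L * s))))
  ... | _ | tri> _ _ b<c = contradiction (sym eq) (<⇒≢ (begin-strict
      B a * B b * (1 + L * s) ≡⟨ rotate′ (B a) (B b) (1 + L * s) ⟩
      B a * (1 + L * s) * B b <⟨ *-monoʳ-< (B a * (1 + L * s)) ⦃ >-nonZero (*-mono-< (0<B a) z<s) ⦄ (+-monoʳ-< M b<c) ⟩
      B a * (1 + L * s) * B c ≤⟨ *-monoˡ-≤ (B c) lower ⟩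
      e * B c                 ∎))
    where open ≤-Reasoning

  private
    instance
      Q-nonZero : NonZero Q
      Q-nonZero = >-nonZero (≤-trans 0<K (m≤n+m K (2 * (K * K * K))))

    0<L*Q^ : ∀ i → 0 < L * Q ^ i
    0<L*Q^ i = *-mono-< (1≤n! K) (m^n>0 Q i)

  level-gap : ∀ {bu bv bu′ bv′ i i′} → i < i′ → bu ≤ K → bv ≤ K → 0 < bu′ → 0 < bv′ →
              K * (bu * bv * (1 + L * Q ^ i) + 1) < bu′ * bv′ * (1 + L * Q ^ i′)
  level-gap {bu} {bv} {bu′} {bv′} {i} {i′} i<i′ bu≤K bv≤K 0<bu′ 0<bv′ = begin-strict
    K * (bu * bv * (1 + x) + 1)          ≤⟨ *-monoʳ-≤ K (+-monoˡ-≤ 1 (*-monoˡ-≤ (1 + x) (*-mono-≤ bu≤K bv≤K))) ⟩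
    K * (K * K * (1 + x) + 1)            ≡⟨ expand K x ⟩
    K * K * K + K * K * K * x + K        ≤⟨ +-mono-≤ (+-monoˡ-≤ (K * K * K * x) (m≤m*n (K * K * K) x)) (m≤m*n K x) ⟩
    K * K * K * x + K * K * K * x + K * x ≡⟨ collect K x ⟩
    x * Q                                <⟨ n<1+n (x * Q) ⟩
    1 + x * Q                            ≡⟨ cong (1 +_) (reassoc L (Q ^ i) Q) ⟩
    1 + L * (Q * Q ^ i)                  ≤⟨ +-monoʳ-≤ 1 (*-monoʳ-≤ L (^-monoʳ-≤ Q i<i′)) ⟩
    1 + L * Q ^ i′                       ≤⟨ m≤n*m (1 + L * Q ^ i′) (bu′ * bv′) ⦃ >-nonZero (*-mono-< 0<bu′ 0<bv′) ⦄ ⟩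
    bu′ * bv′ * (1 + L * Q ^ i′)         ∎
    where
    open ≤-Reasoning
    x = L * Q ^ i
    instance
      x-nonZero : NonZero x
      x-nonZero = >-nonZero (0<L*Q^ i)
    expand : ∀ K x → K * (K * K * (1 + x) + 1) ≡ K * K * K + K * K * K * x + K
    expand = solve-∀
    collect : ∀ K x → K * K * K * x + K * K * K * x + K * x ≡ x * (2 * (K * K * K) + K)
    collect = solve-∀
    reassoc : ∀ L y Q → L * y * Q ≡ L * (Q * y)
    reassoc = solve-∀

  c<K*[c+1] : ∀ c → c < K * (c + 1)
  c<K*[c+1] c = ≤-trans (≤-reflexive (+-comm 1 c)) (m≤n*m (c + 1) K ⦃ >-nonZero 0<K ⦄)

  0<C : ∀ u v → 0 < C u v
  0<C u v = *-mono-< (*-mono-< (0<B (toℕ u)) (0<B (toℕ v))) z<s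

  levels-apart : ∀ u v u′ v′ → ¬ (u ≡ u′ × v ≡ v′) →
                 K * (C u v + 1) < C u′ v′ ⊎ K * (C u′ v′ + 1) < C u v
  levels-apart u v u′ v′ ≢ with <-cmp (toℕ (Fin.combine u v)) (toℕ (Fin.combine u′ v′))
  ... | tri< i<i′ _ _ = inj₁ (level-gap i<i′ (B≤K (toℕ<n u)) (B≤K (toℕ<n v)) (0<B _) (0<B _))
  ... | tri> _ _ i′<i = inj₂ (level-gap i′<i (B≤K (toℕ<n u′)) (B≤K (toℕ<n v′)) (0<B _) (0<B _))
  ... | tri≈ _ i≡i′ _ = contradiction (combine-injective u v u′ v′ (toℕ-injective i≡i′)) ≢

  levels-distinct : ∀ u v u′ v′ → ¬ (u ≡ u′ × v ≡ v′) → C u v ≢ C u′ v′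
  levels-distinct u v u′ v′ ≢ with levels-apart u v u′ v′ ≢
  ... | inj₁ gap = <⇒≢ (<-trans (c<K*[c+1] (C u v)) gap)
  ... | inj₂ gap = <⇒≢ (<-trans (c<K*[c+1] (C u′ v′)) gap) ∘ sym

  C≤Z : ∀ u v → C u v ≤ Z
  C≤Z u v = *-mono-≤ (*-mono-≤ (B≤K (toℕ<n u)) (B≤K (toℕ<n v)))
                     (+-monoʳ-≤ 1 (*-monoʳ-≤ L (^-monoʳ-≤ Q (<⇒≤ (toℕ<n (Fin.combine u v))))))

  B≤Z : ∀ {a} → a < N → B a ≤ Z
  B≤Z a<N = ≤-trans (B≤K a<N) (≤-trans (n≤n*n K) (m≤m*n (K * K) (1 + L * Q ^ (N * N))))

  B<C : ∀ {a} → a < N → ∀ u v → B a < C u v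
  B<C {a} a<N u v = begin-strict
    B a                     <⟨ +-monoʳ-< M a<N ⟩
    M + N                   ≤⟨ +-monoʳ-≤ M (≤-trans (n≤n*n N) (m≤m+n (N * N) 2)) ⟩
    M + M                   ≡⟨ cong (M +_) (*-identityˡ M) ⟨
    2 * M                   ≤⟨ *-monoˡ-≤ M 2≤M ⟩
    M * M                   ≤⟨ *-mono-≤ (m≤m+n M (toℕ u)) (m≤m+n M (toℕ v)) ⟩
    B (toℕ u) * B (toℕ v)   ≤⟨ m≤m*n _ (T u v) ⟩
    C u v                   ∎
    where open ≤-Reasoning

  height≤C : ∀ u v j → height u v j ≤ C u v
  height≤C u v j = ≤-trans (m∸n≤m _ j) (≤-trans (m≤n*m _ (B (toℕ u)) ⦃ >-nonZero (0<B _) ⦄)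
                                             (≤-reflexive (sym (*-assoc (B (toℕ u)) _ _))))

  module EdgePath (u v : Fin N) (u<v : toℕ u < toℕ v) where

    top≡bottom+D : B (toℕ v) * T u v ≡ B (toℕ u) * T u v + D u v
    top≡bottom+D = begin
      B (toℕ v) * T u v                        ≡⟨ cong (λ b → B b * T u v) (m+[n∸m]≡n (<⇒≤ u<v)) ⟨
      B (toℕ u + (toℕ v ∸ toℕ u)) * T u v      ≡⟨ distribute M (toℕ u) (toℕ v ∸ toℕ u) (T u v) ⟩
      B (toℕ u) * T u v + D u v                ∎
      where
      open ≡-Reasoning
      distribute : ∀ M a δ t → (M + (a + δ)) * t ≡ (M + a) * t + δ * t
      distribute = solve-∀

    D≤top : D u v ≤ B (toℕ v) * T u v
    D≤top = ≤-trans (m≤n+m (D u v) _) (≤-reflexive (sym top≡bottom+D))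

    height-D : height u v (D u v) ≡ B (toℕ u) * T u v
    height-D = trans (cong (_∸ D u v) top≡bottom+D) (m+n∸n≡m _ (D u v))

    bottom≤height : ∀ {j} → j ≤ D u v → B (toℕ u) * T u v ≤ height u v j
    bottom≤height j≤D = ≤-trans (≤-reflexive (sym height-D)) (∸-monoʳ-≤ _ j≤D)

    C≤K*height : ∀ {j} → j ≤ D u v → C u v ≤ K * height u v j
    C≤K*height j≤D = ≤-trans (≤-reflexive (regroup (B (toℕ u)) (B (toℕ v)) (T u v)))
                             (*-mono-≤ (B≤K (toℕ<n v)) (bottom≤height j≤D))
      where
      regroup : ∀ x y t → x * y * t ≡ y * (x * t)
      regroup = solve-∀

    height-injective : ∀ {j j′} → j ≤ D u v → j′ ≤ D u v → height u v j ≡ height u v j′ → j ≡ j′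
    height-injective j≤D j′≤D = ∸-cancelˡ-≡ (≤-trans j≤D D≤top) (≤-trans j′≤D D≤top)

    height-step : ∀ {j j′} → j′ ≤ D u v → j′ ≡ suc j → height u v j ≡ suc (height u v j′)
    height-step {j} j′≤D refl = begin
      height u v j                  ≡⟨ suc-pred (height u v j) ⦃ ≢-nonZero (m>n⇒m∸n≢0 (≤-trans j′≤D D≤top)) ⦄ ⟨
      suc (pred (height u v j))     ≡⟨ cong suc (pred[m∸n]≡m∸[1+n] _ j) ⟩
      suc (height u v (suc j))      ∎
      where open ≡-Reasoning

    height-step⁻ : ∀ {j j′} → j ≤ D u v → j′ ≤ D u v → height u v j ≡ suc (height u v j′) → j′ ≡ suc j
    height-step⁻ {j} {j′} j≤D j′≤D eq = +-cancelˡ-≡ (height u v j′) j′ (suc j) $ begin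
      height u v j′ + j′        ≡⟨ m∸n+n≡m (≤-trans j′≤D D≤top) ⟩
      B (toℕ v) * T u v         ≡⟨ m∸n+n≡m (≤-trans j≤D D≤top) ⟨
      height u v j + j          ≡⟨ cong (_+ j) eq ⟩
      suc (height u v j′) + j   ≡⟨ +-suc (height u v j′) j ⟨
      height u v j′ + suc j     ∎
      where open ≡-Reasoning

    C≡height-0*B : C u v ≡ height u v 0 * B (toℕ u)
    C≡height-0*B = rotate (B (toℕ u)) (B (toℕ v)) (T u v)

    C≡height-D*B : C u v ≡ height u v (D u v) * B (toℕ v)
    C≡height-D*B = trans (rotate′ (B (toℕ u)) (B (toℕ v)) (T u v)) (cong (_* B (toℕ v)) (sym height-D))

    attached-ends : ∀ {w j} → j ≤ D u v → height u v j * B w ≡ C u v →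
                    w ≡ toℕ u × j ≡ 0 ⊎ w ≡ toℕ v × j ≡ D u v
    attached-ends {w} {j} j≤D eq =
      Sum.map (map₂ (λ top → height-injective j≤D z≤n top))
              (map₂ (λ bottom → height-injective j≤D ≤-refl (trans bottom (sym height-D))))
              (B-cofactor-at-ends (Q ^ toℕ (Fin.combine u v)) u<v (toℕ<n v) (bottom≤height j≤D) (m∸n≤m _ j) eq)

module Construction (G : Graph) where
  open Parameters (n G)

  inner-count : Fin (n G) → Fin (n G) → ℕ
  inner-count u v with edge? G u v
  ... | yes _ = suc (D u v)
  ... | no _  = 0

  inner-edge : ∀ {u v} → Fin (inner-count u v) → Edge G u v
  inner-edge {u} {v} j with edge? G u v
  ... | yes uv = uv

  inner-count-edge : ∀ {u v} → Edge G u v → inner-count u v ≡ suc (D u v)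
  inner-count-edge {u} {v} uv with edge? G u v
  ... | yes _  = refl
  ... | no ¬uv = contradiction uv ¬uv

  index≤D : ∀ {u v} (j : Fin (inner-count u v)) → toℕ j ≤ D u v
  index≤D {u} {v} j with edge? G u v
  ... | yes _ = ≤-pred (toℕ<n j)

  Inner : Set
  Inner = Σ (Fin (n G)) λ u → Σ (Fin (n G)) λ v → Fin (inner-count u v)

  Vertex : Set
  Vertex = Fin (n G) ⊎ Inner

  levelOf : Vertex → ℕ
  levelOf (inj₁ w)           = B (toℕ w)
  levelOf (inj₂ (u , v , _)) = C u v

  heightOf : Vertex → ℕ
  heightOf (inj₁ _)           = 0
  heightOf (inj₂ (u , v , j)) = height u v (toℕ j)

  0<level : ∀ x → 0 < levelOf x
  0<level (inj₁ w)           = 0<B (toℕ w)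
  0<level (inj₂ (u , v , _)) = 0<C u v

  level≤Z : ∀ x → levelOf x ≤ Z
  level≤Z (inj₁ w)           = B≤Z (toℕ<n w)
  level≤Z (inj₂ (u , v , _)) = C≤Z u v

  height≤Z : ∀ x → heightOf x ≤ Z
  height≤Z (inj₁ _)           = z≤n
  height≤Z (inj₂ (u , v , j)) = ≤-trans (height≤C u v (toℕ j)) (C≤Z u v)

  ℓ : Vertex → ℕ
  ℓ x = label (scale Z) (levelOf x) (heightOf x)

  ℓ-pos : ∀ x → 0 < ℓ x
  ℓ-pos x = label-pos (heightOf x) (0<scale {Z}) (0<level x)

  descriptor-injective : ∀ x y → levelOf x ≡ levelOf y → heightOf x ≡ heightOf y → x ≡ y
  descriptor-injective (inj₁ w) (inj₁ w′) eq _ = cong inj₁ (toℕ-injective (+-cancelˡ-≡ M _ _ eq))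
  descriptor-injective (inj₁ w) (inj₂ (u , v , _)) eq _ = contradiction eq (<⇒≢ (B<C (toℕ<n w) u v))
  descriptor-injective (inj₂ (u , v , _)) (inj₁ w) eq _ = contradiction (sym eq) (<⇒≢ (B<C (toℕ<n w) u v))
  descriptor-injective (inj₂ (u , v , j)) (inj₂ (u′ , v′ , j′)) eq eq′ with u Fin.≟ u′ ×-dec v Fin.≟ v′
  ... | no ≢              = contradiction eq (levels-distinct u v u′ v′ ≢)
  ... | yes (refl , refl) = cong (λ i → inj₂ (u , v , i)) (toℕ-injective
      (EdgePath.height-injective u v (proj₁ (inner-edge j)) (index≤D j) (index≤D j′) eq′))

  ℓ-injective : Injective _≡_ _≡_ ℓ
  ℓ-injective {x} {y} eq with small-label-injective (height≤Z x) (height≤Z y) eq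
  ... | same-level , same-height = descriptor-injective x y same-level same-height

  enum : Fin (n G + ∑ (n G) (λ u → ∑ (n G) (inner-count u))) ↔ Vertex
  enum = ↔-trans +↔⊎ (↔-refl ⊎-↔ ↔-trans (Fin-∑↔Σ _ _) (Σ-↔ ↔-refl (Fin-∑↔Σ _ _)))

  open DiophantineGraph enum ℓ ℓ-pos public using (adj⇔square; graph-diophantine) renaming (graph to H)
  open Inverse enum using (to; from; strictlyInverseˡ; strictlyInverseʳ)

  φ : Fin (n G) → Fin (n H)
  φ w = from (inj₁ w)

  inner-vertex : ∀ u v → Fin (inner-count u v) → Fin (n H)
  inner-vertex u v j = from (inj₂ (u , v , j))

  inner : Fin (n G) → Fin (n G) → List (Fin (n H))
  inner u v = tabulate (inner-vertex u v)

  path : Fin (n G) → Fin (n G) → List (Fin (n H))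
  path u v = φ u ∷ inner u v ++ [ φ v ]

  from-injective : ∀ {a b} → from a ≡ from b → a ≡ b
  from-injective {a} {b} eq = trans (sym (strictlyInverseˡ a)) (trans (cong to eq) (strictlyInverseˡ b))

  adjacent : ∀ a b → IsSquare (ℓ a * ℓ b + 1) → Adj H (from a) (from b)
  adjacent a b = Equivalence.from (adj⇔square a b)

  module _ {u v} (uv : Edge G u v) where
    open EdgePath u v (proj₁ uv)

    private
      S = scale Z
      x⟨_⟩ : Fin (inner-count u v) → Vertex
      x⟨ j ⟩ = inj₂ (u , v , j)

    adjacent-first : ∀ j → toℕ j ≡ 0 → Adj H (φ u) (inner-vertex u v j)
    adjacent-first j j≡0 = adjacent (inj₁ u) x⟨ j ⟩ $
      subst (λ i → IsSquare (ℓ (inj₁ u) * label S (C u v) (height u v i) + 1)) (sym j≡0) $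
      subst (λ c → IsSquare (label S (B (toℕ u)) 0 * label S c (height u v 0) + 1)) (sym C≡height-0*B) $
      label-multiple-square S (B (toℕ u)) (height u v 0)

    adjacent-step : ∀ j j′ → toℕ j′ ≡ suc (toℕ j) → Adj H (inner-vertex u v j) (inner-vertex u v j′)
    adjacent-step j j′ j′≡1+j = adjacent x⟨ j ⟩ x⟨ j′ ⟩ $
      subst (λ e → IsSquare (label S (C u v) e * ℓ x⟨ j′ ⟩ + 1)) (sym (height-step (index≤D j′) j′≡1+j)) $
      label-suc-square S (C u v) (height u v (toℕ j′))

    last-index : ∀ (j : Fin (inner-count u v)) → suc (toℕ j) ≡ inner-count u v → toℕ j ≡ D u v
    last-index j eq = suc-injective (trans eq (inner-count-edge {u} {v} uv))

    adjacent-last : ∀ j → suc (toℕ j) ≡ inner-count u v → Adj H (inner-vertex u v j) (φ v)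
    adjacent-last j last = adjacent x⟨ j ⟩ (inj₁ v) $
      subst (λ i → IsSquare (label S (C u v) (height u v i) * ℓ (inj₁ v) + 1)) (sym (last-index j last)) $
      subst (λ c → IsSquare (label S c (height u v (D u v)) * label S (B (toℕ v)) 0 + 1)) (sym C≡height-D*B) $
      isSquare-comm _ (label S (height u v (D u v) * B (toℕ v)) (height u v (D u v)))
        (label-multiple-square S (B (toℕ v)) (height u v (D u v)))

    path-linked : Linked (Adj H) (path u v)
    path-linked = linked-tabulate (inner-vertex u v)
      (λ count≡0 → contradiction (trans (sym (inner-count-edge {u} {v} uv)) count≡0) λ ())
      adjacent-first adjacent-step adjacent-last

  Covered : Fin (n H) → Fin (n H) → Set
  Covered x y = ∃[ u ] ∃[ v ] u Fin.< v × Adj G u v × (Consec x y (path u v) ⊎ Consec y x (path u v))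

  covered-by : ∀ {x y u v} → Edge G u v → Consec x y (path u v) ⊎ Consec y x (path u v) → Covered x y
  covered-by (u<v , uv) consec = _ , _ , u<v , uv , consec

  covered-sym : ∀ {x y} → Covered x y → Covered y x
  covered-sym (u , v , u<v , uv , consec) = u , v , u<v , uv , Sum.swap consec

  branch-inner-covered : ∀ w {u v} (j : Fin (inner-count u v)) →
                         Balanced (B (toℕ w)) 0 (C u v) (height u v (toℕ j)) →
                         Covered (φ w) (inner-vertex u v j)
  branch-inner-covered w {u} {v} j balanced with attached-ends {toℕ w} (index≤D j) attaches
    where
    open EdgePath u v (proj₁ (inner-edge j))
    attaches = balanced-0⇒divides {e = height u v (toℕ j)} (0<B (toℕ w)) (0<C u v) balanced
  ... | inj₁ (w≡u , j≡0) = subst (λ w → Covered (φ w) (inner-vertex u v j)) (sym (toℕ-injective w≡u))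
    (covered-by (inner-edge j) $ inj₁ (consec-first (inner-vertex u v) j j≡0))
  ... | inj₂ (w≡v , j≡D) = subst (λ w → Covered (φ w) (inner-vertex u v j)) (sym (toℕ-injective w≡v))
    (covered-by (inner-edge j) $ inj₂ (there (consec-last (inner-vertex u v) j
      (trans (cong suc j≡D) (sym (inner-count-edge {u} {v} (inner-edge j)))))))

  same-edge-covered : ∀ {u v} (j j′ : Fin (inner-count u v)) →
                      Balanced (C u v) (height u v (toℕ j)) (C u v) (height u v (toℕ j′)) →
                      Covered (inner-vertex u v j) (inner-vertex u v j′)
  same-edge-covered {u} {v} j j′ balanced with balanced-same-level (0<C u v) balanced
  ... | inj₁ step = covered-by (inner-edge j) $ inj₁ (there (consec-step (inner-vertex u v) j j′
                      (height-step⁻ (index≤D j) (index≤D j′) step)))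
    where open EdgePath u v (proj₁ (inner-edge j))
  ... | inj₂ step = covered-by (inner-edge j) $ inj₂ (there (consec-step (inner-vertex u v) j′ j
                      (height-step⁻ (index≤D j′) (index≤D j) step)))
    where open EdgePath u v (proj₁ (inner-edge j))

  ¬balanced-different-edges : ∀ {u v u′ v′} (j : Fin (inner-count u v)) (j′ : Fin (inner-count u′ v′)) →
                              ¬ (u ≡ u′ × v ≡ v′) →
                              ¬ Balanced (C u v) (height u v (toℕ j)) (C u′ v′) (height u′ v′ (toℕ j′))
  ¬balanced-different-edges {u} {v} {u′} {v′} j j′ ≢ with levels-apart u v u′ v′ ≢
  ... | inj₁ gap = ¬balanced-apart {K} (0<C u v) (0<C u′ v′) gap
                     (EdgePath.C≤K*height u v (proj₁ (inner-edge j)) (index≤D j)) (height≤C u′ v′ (toℕ j′))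
  ... | inj₂ gap = ¬balanced-apart {K} (0<C u′ v′) (0<C u v) gap
                     (EdgePath.C≤K*height u′ v′ (proj₁ (inner-edge j′)) (index≤D j′)) (height≤C u v (toℕ j))
                   ∘ balanced-sym

  balanced⇒covered : ∀ a b → Balanced (levelOf a) (heightOf a) (levelOf b) (heightOf b) →
                     Covered (from a) (from b)
  balanced⇒covered (inj₁ w) (inj₁ w′) balanced = contradiction balanced (¬balanced-0-0 (0<B _) (0<B _))
  balanced⇒covered (inj₁ w) (inj₂ (u , v , j)) balanced = branch-inner-covered w j balanced
  balanced⇒covered (inj₂ (u , v , j)) (inj₁ w) balanced =
    covered-sym (branch-inner-covered w j (balanced-sym balanced))
  balanced⇒covered (inj₂ (u , v , j)) (inj₂ (u′ , v′ , j′)) balanced with u Fin.≟ u′ ×-dec v Fin.≟ v′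
  ... | yes (refl , refl) = same-edge-covered j j′ balanced
  ... | no ≢              = contradiction balanced (¬balanced-different-edges j j′ ≢)

  adjacent-covered : ∀ x y → Adj H x y → Covered x y
  adjacent-covered x y xy = subst₂ Covered (strictlyInverseʳ x) (strictlyInverseʳ y) $
    balanced⇒covered (to x) (to y) $
    small-label-square⇒balanced (0<level (to x)) (0<level (to y))
      (level≤Z (to x)) (height≤Z (to x)) (level≤Z (to y)) (height≤Z (to y)) $
    Equivalence.to (adj⇔square (to x) (to y))
      (subst₂ (Adj H) (sym (strictlyInverseʳ x)) (sym (strictlyInverseʳ y)) xy)

  inner-vertex-injective : ∀ {u v u′ v′ j j′} → inner-vertex u v j ≡ inner-vertex u′ v′ j′ →
                           _≡_ {A = Inner} (u , v , j) (u′ , v′ , j′)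
  inner-vertex-injective {u} {v} {u′} {v′} {j} {j′} =
    inj₂-injective ∘ from-injective {inj₂ (u , v , j)} {inj₂ (u′ , v′ , j′)}

  φ≢inner-vertex : ∀ w {u v} j → φ w ≢ inner-vertex u v j
  φ≢inner-vertex w {u} {v} j eq with from-injective {inj₁ w} {inj₂ (u , v , j)} eq
  ... | ()

  vertex-kinds : ∀ x → (∃[ w ] φ w ≡ x) ⊎ (∃[ u ] ∃[ v ] u Fin.< v × Adj G u v × x ∈ inner u v)
  vertex-kinds x with to x | strictlyInverseʳ x
  ... | inj₁ w           | φw≡x = inj₁ (w , φw≡x)
  ... | inj₂ (u , v , j) | x≡  = inj₂ (u , v , proj₁ (inner-edge j) , proj₂ (inner-edge j) ,
                                        subst (_∈ inner u v) x≡ (∈-tabulate⁺ j))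

  subdivision : SubdivisionOf H G
  subdivision = record
    { φ              = φ
    ; φ-inj          = inj₁-injective ∘ from-injective
    ; inner          = inner
    ; path-is-path   = λ u v u<v uv → path-linked (u<v , uv)
    ; inner-unique   = λ u v _ _ → tabulate⁺ (same-index ∘ inner-vertex-injective)
    ; inner-new      = λ u v _ _ x x∈ w φw≡x → case ∈-tabulate⁻ x∈ of λ where
                         (j , refl) → φ≢inner-vertex w j φw≡x
    ; inner-disj     = inner-disjoint
    ; cover-vertices = vertex-kinds
    ; cover-edges    = adjacent-covered
    }
    where
    same-index : ∀ {u v j j′} → _≡_ {A = Inner} (u , v , j) (u , v , j′) → j ≡ j′
    same-index refl = refl
    inner-disjoint : ∀ u v u′ v′ → u Fin.< v → Adj G u v → u′ Fin.< v′ → Adj G u′ v′ →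
                     u ≢ u′ ⊎ v ≢ v′ → ∀ x → x ∈ inner u v → x ∉ inner u′ v′
    inner-disjoint u v u′ v′ _ _ _ _ ≢ x x∈ x∈′ with ∈-tabulate⁻ x∈ | ∈-tabulate⁻ x∈′
    ... | j , refl | j′ , eq with inner-vertex-injective eq
    ... | refl = Sum.[ (λ u≢u → u≢u refl) , (λ v≢v → v≢v refl) ]′ ≢

corollary1 : (G : Graph) →
    (Σ Graph λ H → IsDiophantine H × SubdivisionOf H G)
    × (Σ Graph λ H → IsDiophantine H × MinorOf G H)
corollary1 G =
    (H , diophantine , subdivision)
  , (H , diophantine , subdivision⇒minor subdivision)
  where
  open Construction G using (H; subdivision; graph-diophantine; ℓ-injective)
  diophantine : IsDiophantine H
  diophantine = graph-diophantine ℓ-injective
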